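{- For all integers $m,n\ge 1$, \begin{align*} w_{n}U_{m+1}+qw_{n-1}U_{m}&=W_{n+m},\\ u_{n}W_{m+1}+qu_{n-1}W_{m}&=W_{n+m},\\ W_{m+1}U_{n+1}+qW_{m}U_{n}&=U_{2}W_{m+n}+qU_{1}W_{m+n-1},\\ W_{m+1}W_{n+1}+qW_{m}W_{n}&=W_{2}W_{m+n}+qW_{1}W_{m+n-1}. \end{align*}
   Context: Let $H$ be the real quaternion algebra with basis $1,i,j,k$ and (non-commutative) multiplication determined by $i^2=j^2=k^2=-1$, $ij=-ji=k$, $jk=-kj=i$, $ki=-ik=j$; real scalars commute with all quaternions. Fix real numbers $p,q$. The Horadam sequence $w_n=w_n(w_0,w_1;p,q)$ has real initial values $w_0,w_1$ and satisfies $w_n=pw_{n-1}+qw_{n-2}$ for $n\ge 2$. Let $u_n=w_n(0,1;p,q)$ (the $(p,q)$-Fibonacci numbers). The Horadam quaternions are $W_n=w_n+w_{n+1}i+w_{n+2}j+w_{n+3}k$, and the $(p,q)$-Fibonacci quaternions are $U_n=u_n+u_{n+1}i+u_{n+2}j+u_{n+3}k$. -}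

module Defs where

open import Level using (_⊔_)
open import Data.Nat using (ℕ; zero; suc)
open import Data.Product using (_×_)
open import Algebra.Bundles using (CommutativeRing)

module Quaternion {c ℓ} (R : CommutativeRing c ℓ) where
  open CommutativeRing R

  record Quat : Set c where
    constructor quat
    field
      re ii jj kk : Carrier
  open Quat public

  infix 4 _≈Q_
  _≈Q_ : Quat → Quat → Set ℓ
  a ≈Q b = (re a ≈ re b) × (ii a ≈ ii b) × (jj a ≈ jj b) × (kk a ≈ kk b)

  infixl 6 _+Q_
  _+Q_ : Quat → Quat → Quat
  a +Q b = quat (re a + re b) (ii a + ii b) (jj a + jj b) (kk a + kk b)

  infixl 7 _·Q_
  _·Q_ : Carrier → Quat → Quat
  r ·Q a = quat (r * re a) (r * ii a) (r * jj a) (r * kk a)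

  -- Hamilton product: i² = j² = k² = -1, ij = k = -ji, jk = i = -kj, ki = j = -ik
  infixl 7 _*Q_
  _*Q_ : Quat → Quat → Quat
  (quat a₁ b₁ c₁ d₁) *Q (quat a₂ b₂ c₂ d₂) = quat
    (a₁ * a₂ - b₁ * b₂ - c₁ * c₂ - d₁ * d₂)
    (a₁ * b₂ + b₁ * a₂ + c₁ * d₂ - d₁ * c₂)
    (a₁ * c₂ - b₁ * d₂ + c₁ * a₂ + d₁ * b₂)
    (a₁ * d₂ + b₁ * c₂ - c₁ * b₂ + d₁ * a₂)

  horadam : (w₀ w₁ p q : Carrier) → ℕ → Carrier
  horadam w₀ w₁ p q zero = w₀
  horadam w₀ w₁ p q (suc zero) = w₁
  horadam w₀ w₁ p q (suc (suc n)) =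
    p * horadam w₀ w₁ p q (suc n) + q * horadam w₀ w₁ p q n

  fib : (p q : Carrier) → ℕ → Carrier
  fib p q = horadam 0# 1# p q

  horadamQ : (w₀ w₁ p q : Carrier) → ℕ → Quat
  horadamQ w₀ w₁ p q n =
    quat (w n) (w (suc n)) (w (suc (suc n))) (w (suc (suc (suc n))))
    where w = horadam w₀ w₁ p q

  fibQ : (p q : Carrier) → ℕ → Quat
  fibQ p q = horadamQ 0# 1# p q

-- For sequences f, g satisfying the Horadam recurrence, f (a+1) g (b+1) + q f a g b is unchanged
-- by (a, b) ↦ (a+1, b−1), hence depends only on a + b; for g = u (u₀ = 0, u₁ = 1) it therefore
-- equals f (a+b+1). The quaternions W_n, U_n are windows of four consecutive terms and the Hamilton
-- product is bilinear, so every coordinate of each of the four identities is one of these two facts.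
module Submission where

open import Defs
open import Level using (Level)
import Data.Nat as Nat
open Nat using (ℕ; zero; suc)
import Data.Nat.Properties as ℕₚ
open import Data.Nat.Tactic.RingSolver using (solve)
open import Data.List using (_∷_; [])
open import Data.Product using (_×_; _,_)
open import Data.Sign using (Sign)
open import Algebra.Bundles using (CommutativeRing)
open import Relation.Binary.Bundles using (Setoid)
open import Relation.Binary.PropositionalEquality as ≡ using (_≡_)
import Algebra.Properties.AbelianGroup as AbelianGroupProperties
import Algebra.Properties.CommutativeSemigroup as CommutativeSemigroupProperties
import Algebra.Properties.Ring as RingProperties
import Algebra.Solver.Ring.NaturalCoefficients.Default as NaturalCoefficientsSolver
import Relation.Binary.Reasoning.Setoid as SetoidReasoning

module HoradamQuaternions {c ℓ} (R : CommutativeRing c ℓ) where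
  open CommutativeRing R
  open Quaternion R
  open AbelianGroupProperties +-abelianGroup using (⁻¹-∙-comm)
  open CommutativeSemigroupProperties +-commutativeSemigroup using (interchange)
  open RingProperties ring using (-‿distribʳ-*)

  quatSetoid : Setoid c ℓ
  quatSetoid = record
    { Carrier = Quat
    ; _≈_ = _≈Q_
    ; isEquivalence = record
      { refl = refl , refl , refl , refl
      ; sym = λ (r , i , j , k) → sym r , sym i , sym j , sym k
      ; trans = λ (r , i , j , k) (r′ , i′ , j′ , k′) →
          trans r r′ , trans i i′ , trans j j′ , trans k k′
      }
    }

  open Setoid quatSetoid using () renaming (trans to ≈Q-trans)

  signed : Sign → Carrier → Carrier
  signed Sign.+ x = x
  signed Sign.- x = - x

  infixl 6 _+[_]_
  _+[_]_ : Carrier → Sign → Carrier → Carrier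
  x +[ s ] y = x + signed s y

  +[]-cong : ∀ s {x x′ y y′} → x ≈ x′ → y ≈ y′ → x +[ s ] y ≈ x′ +[ s ] y′
  +[]-cong Sign.+ x≈x′ y≈y′ = +-cong x≈x′ y≈y′
  +[]-cong Sign.- x≈x′ y≈y′ = +-cong x≈x′ (-‿cong y≈y′)

  +-linear : ∀ r x y x′ y′ → x + y + r * (x′ + y′) ≈ (x + r * x′) + (y + r * y′)
  +-linear r x y x′ y′ = trans (+-congˡ (distribˡ r x′ y′)) (interchange x y (r * x′) (r * y′))

  signed-linear : ∀ s r y y′ → signed s y + r * signed s y′ ≈ signed s (y + r * y′)
  signed-linear Sign.+ r y y′ = refl
  signed-linear Sign.- r y y′ =
    trans (+-congˡ (sym (-‿distribʳ-* r y′))) (⁻¹-∙-comm y (r * y′))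

  +[]-linear : ∀ s r x y x′ y′ → x +[ s ] y + r * (x′ +[ s ] y′) ≈ (x + r * x′) +[ s ] (y + r * y′)
  +[]-linear s r x y x′ y′ = trans (+-linear r x _ x′ _) (+-congˡ (signed-linear s r y y′))

  -- With B α β the product of the α-th coordinate of x and the β-th of y, x *Q y is
  -- definitionally hamiltonTable B.
  hamiltonTable : (ℕ → ℕ → Carrier) → Quat
  hamiltonTable B = quat
    (B 0 0 +[ Sign.- ] B 1 1 +[ Sign.- ] B 2 2 +[ Sign.- ] B 3 3)
    (B 0 1 +[ Sign.+ ] B 1 0 +[ Sign.+ ] B 2 3 +[ Sign.- ] B 3 2)
    (B 0 2 +[ Sign.- ] B 1 3 +[ Sign.+ ] B 2 0 +[ Sign.+ ] B 3 1)
    (B 0 3 +[ Sign.+ ] B 1 2 +[ Sign.- ] B 2 1 +[ Sign.+ ] B 3 0)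

  hamiltonTable-cong : ∀ {A B} → (∀ α β → A α β ≈ B α β) → hamiltonTable A ≈Q hamiltonTable B
  hamiltonTable-cong A≈B =
      signedSum-cong Sign.- Sign.- Sign.- (A≈B 0 0) (A≈B 1 1) (A≈B 2 2) (A≈B 3 3)
    , signedSum-cong Sign.+ Sign.+ Sign.- (A≈B 0 1) (A≈B 1 0) (A≈B 2 3) (A≈B 3 2)
    , signedSum-cong Sign.- Sign.+ Sign.+ (A≈B 0 2) (A≈B 1 3) (A≈B 2 0) (A≈B 3 1)
    , signedSum-cong Sign.+ Sign.- Sign.+ (A≈B 0 3) (A≈B 1 2) (A≈B 2 1) (A≈B 3 0)
    where
    signedSum-cong : ∀ s₁ s₂ s₃ {a b c d a′ b′ c′ d′} → a ≈ a′ → b ≈ b′ → c ≈ c′ → d ≈ d′ →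
      a +[ s₁ ] b +[ s₂ ] c +[ s₃ ] d ≈ a′ +[ s₁ ] b′ +[ s₂ ] c′ +[ s₃ ] d′
    signedSum-cong s₁ s₂ s₃ a≈ b≈ c≈ d≈ = +[]-cong s₃ (+[]-cong s₂ (+[]-cong s₁ a≈ b≈) c≈) d≈

  hamiltonTable-linear : ∀ A r B →
    hamiltonTable A +Q r ·Q hamiltonTable B ≈Q hamiltonTable (λ α β → A α β + r * B α β)
  hamiltonTable-linear A r B =
      signedSum-linear Sign.- Sign.- Sign.- (A 0 0) (A 1 1) (A 2 2) (A 3 3) (B 0 0) (B 1 1) (B 2 2) (B 3 3)
    , signedSum-linear Sign.+ Sign.+ Sign.- (A 0 1) (A 1 0) (A 2 3) (A 3 2) (B 0 1) (B 1 0) (B 2 3) (B 3 2)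
    , signedSum-linear Sign.- Sign.+ Sign.+ (A 0 2) (A 1 3) (A 2 0) (A 3 1) (B 0 2) (B 1 3) (B 2 0) (B 3 1)
    , signedSum-linear Sign.+ Sign.- Sign.+ (A 0 3) (A 1 2) (A 2 1) (A 3 0) (B 0 3) (B 1 2) (B 2 1) (B 3 0)
    where
    signedSum-linear : ∀ s₁ s₂ s₃ a b c d a′ b′ c′ d′ →
      a +[ s₁ ] b +[ s₂ ] c +[ s₃ ] d + r * (a′ +[ s₁ ] b′ +[ s₂ ] c′ +[ s₃ ] d′)
        ≈ (a + r * a′) +[ s₁ ] (b + r * b′) +[ s₂ ] (c + r * c′) +[ s₃ ] (d + r * d′)
    signedSum-linear s₁ s₂ s₃ a b c d a′ b′ c′ d′ =
      trans (+[]-linear s₃ r _ d _ d′)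
        (+[]-cong s₃ (trans (+[]-linear s₂ r _ c _ c′)
                            (+[]-cong s₂ (+[]-linear s₁ r a b a′ b′) refl)) refl)

  -- horadamQ x₀ x₁ p q is definitionally window (horadam x₀ x₁ p q).
  window : (ℕ → Carrier) → ℕ → Quat
  window f n = quat (f n) (f (suc n)) (f (suc (suc n))) (f (suc (suc (suc n))))

  window-cong : ∀ {f g} a → (∀ k → f k ≈ g k) → window f a ≈Q window g a
  window-cong a f≈g = f≈g a , f≈g (suc a) , f≈g (suc (suc a)) , f≈g (suc (suc (suc a)))

  module Recurrence (p q : Carrier) where
    open NaturalCoefficientsSolver commutativeSemiring using (_:=_; _:+_; _:*_)
      renaming (solve to solveR)

    IsHoradam : (ℕ → Carrier) → Set ℓ
    IsHoradam f = ∀ n → f (suc (suc n)) ≈ p * f (suc n) + q * f n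

    horadam-isHoradam : ∀ x₀ x₁ → IsHoradam (horadam x₀ x₁ p q)
    horadam-isHoradam x₀ x₁ n = refl

    -- Opaque so that f, g and the indices of a cross f g a b can be found by unification;
    -- the unfolding, built from the non-injective horadam, does not determine them.
    opaque
      cross : (f g : ℕ → Carrier) → ℕ → ℕ → Carrier
      cross f g a b = f (suc a) * g (suc b) + q * (f a * g b)

      cross-comm : ∀ f g a b → cross f g a b ≈ cross g f b a
      cross-comm f g a b = +-cong (*-comm (f (suc a)) (g (suc b))) (*-congˡ (*-comm (f a) (g b)))

      cross-fib-0 : ∀ f a → cross f (fib p q) a 0 ≈ f (suc a)
      cross-fib-0 f a =
        trans (+-cong (*-identityʳ _) (trans (*-congˡ (zeroʳ (f a))) (zeroʳ q))) (+-identityʳ _)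

      cross-shift : ∀ {f g} → IsHoradam f → IsHoradam g →
        ∀ a b → cross f g (suc a) b ≈ cross f g a (suc b)
      cross-shift {f} {g} f-horadam g-horadam a b = begin
        f (2 Nat.+ a) * g (suc b) + q * (f (suc a) * g b)
          ≈⟨ +-congʳ (*-congʳ (f-horadam a)) ⟩
        (p * f (suc a) + q * f a) * g (suc b) + q * (f (suc a) * g b)
          ≈⟨ solveR 6 (λ p q f₁ f₀ g₁ g₀ →
               (p :* f₁ :+ q :* f₀) :* g₁ :+ q :* (f₁ :* g₀)
                 := f₁ :* (p :* g₁ :+ q :* g₀) :+ q :* (f₀ :* g₁))
             refl p q (f (suc a)) (f a) (g (suc b)) (g b) ⟩
        f (suc a) * (p * g (suc b) + q * g b) + q * (f a * g (suc b))
          ≈⟨ +-congʳ (*-congˡ (g-horadam b)) ⟨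
        f (suc a) * g (2 Nat.+ b) + q * (f a * g (suc b)) ∎
        where open SetoidReasoning setoid

    module _ {f g} (f-horadam : IsHoradam f) (g-horadam : IsHoradam g) where

      cross-sum : ∀ a b → cross f g a b ≈ cross f g 0 (a Nat.+ b)
      cross-sum zero b = refl
      cross-sum (suc a) b = trans (cross-shift f-horadam g-horadam a b)
        (trans (cross-sum a (suc b)) (reflexive (≡.cong (cross f g 0) (ℕₚ.+-suc a b))))

      cross-invariant : ∀ {a b a′ b′} → a Nat.+ b ≡ a′ Nat.+ b′ → cross f g a b ≈ cross f g a′ b′
      cross-invariant {a} {b} {a′} {b′} eq =
        trans (cross-sum a b) (trans (reflexive (≡.cong (cross f g 0) eq)) (sym (cross-sum a′ b′)))

    cross-fib : ∀ {f a b c} → IsHoradam f → a Nat.+ b ≡ c → cross f (fib p q) a b ≈ f (suc c)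
    cross-fib {f} {a} {b} f-horadam ≡.refl =
      trans (cross-invariant f-horadam (horadam-isHoradam 0# 1#) (≡.sym (ℕₚ.+-identityʳ (a Nat.+ b))))
            (cross-fib-0 f (a Nat.+ b))

    crossQ : (f g : ℕ → Carrier) → ℕ → ℕ → Quat
    crossQ f g a b = hamiltonTable (λ α β → cross f g (α Nat.+ a) (β Nat.+ b))

    crossQ-cong : ∀ {f g a b f′ g′ a′ b′} →
      (∀ α β → cross f g (α Nat.+ a) (β Nat.+ b) ≈ cross f′ g′ (α Nat.+ a′) (β Nat.+ b′)) →
      crossQ f g a b ≈Q crossQ f′ g′ a′ b′
    crossQ-cong = hamiltonTable-cong

    opaque
      unfolding cross

      window-cross : ∀ {f g a b a₁ b₁} → a₁ ≡ suc a → b₁ ≡ suc b →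
        window f a₁ *Q window g b₁ +Q q ·Q (window f a *Q window g b) ≈Q crossQ f g a b
      window-cross {f} {g} {a} {b} ≡.refl ≡.refl =
        ≈Q-trans (hamiltonTable-linear (λ α β → f (α Nat.+ suc a) * g (β Nat.+ suc b)) q
                                       (λ α β → f (α Nat.+ a) * g (β Nat.+ b)))
                 (hamiltonTable-cong λ α β → reflexive
                   (≡.cong₂ (λ i j → f i * g j + q * (f (α Nat.+ a) * g (β Nat.+ b)))
                            (ℕₚ.+-suc α a) (ℕₚ.+-suc β b)))

      window-scaled-cross : ∀ {f g a b a₁} → a₁ ≡ suc a →
        g (suc b) ·Q window f a₁ +Q (q * g b) ·Q window f a ≈Q window (cross g f b) a
      window-scaled-cross {f} {g} {a} {b} ≡.refl =
        reassoc a , reassoc (suc a) , reassoc (suc (suc a)) , reassoc (suc (suc (suc a)))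
        where
        reassoc : ∀ k → g (suc b) * f (suc k) + q * g b * f k ≈ cross g f b k
        reassoc k = +-congˡ (*-assoc q (g b) (f k))

  module HoradamIdentities (p q w₀ w₁ : Carrier) where
    open Recurrence p q
    open SetoidReasoning quatSetoid

    w u : ℕ → Carrier
    w = horadam w₀ w₁ p q
    u = fib p q

    W U : ℕ → Quat
    W = horadamQ w₀ w₁ p q
    U = fibQ p q

    w-horadam : IsHoradam w
    w-horadam = horadam-isHoradam w₀ w₁

    u-horadam : IsHoradam u
    u-horadam = horadam-isHoradam 0# 1#

    horadamQ-by-fibQ : ∀ m n →
      w (suc n) ·Q U (m Nat.+ 1) +Q (q * w n) ·Q U m ≈Q W (suc n Nat.+ m)
    horadamQ-by-fibQ m n = begin
      w (suc n) ·Q U (m Nat.+ 1) +Q (q * w n) ·Q U m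
        ≈⟨ window-scaled-cross (ℕₚ.+-comm m 1) ⟩
      window (cross w u n) m
        ≈⟨ window-cong m (λ k → cross-fib w-horadam (ℕₚ.+-comm n k)) ⟩
      W (suc (m Nat.+ n))
        ≡⟨ ≡.cong (λ k → W (suc k)) (ℕₚ.+-comm m n) ⟩
      W (suc n Nat.+ m) ∎

    horadamQ-by-fib : ∀ m n →
      u (suc n) ·Q W (m Nat.+ 1) +Q (q * u n) ·Q W m ≈Q W (suc n Nat.+ m)
    horadamQ-by-fib m n = begin
      u (suc n) ·Q W (m Nat.+ 1) +Q (q * u n) ·Q W m
        ≈⟨ window-scaled-cross (ℕₚ.+-comm m 1) ⟩
      window (cross u w n) m
        ≈⟨ window-cong m (λ k → trans (cross-comm u w n k) (cross-fib w-horadam ≡.refl)) ⟩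
      W (suc (m Nat.+ n))
        ≡⟨ ≡.cong (λ k → W (suc k)) (ℕₚ.+-comm m n) ⟩
      W (suc n Nat.+ m) ∎

    horadamQ-fibQ-product : ∀ m n →
      W (suc m Nat.+ 1) *Q U (suc n Nat.+ 1) +Q q ·Q (W (suc m) *Q U (suc n))
        ≈Q U 2 *Q W (suc m Nat.+ suc n) +Q q ·Q (U 1 *Q W (m Nat.+ suc n))
    horadamQ-fibQ-product m n = begin
      W (suc m Nat.+ 1) *Q U (suc n Nat.+ 1) +Q q ·Q (W (suc m) *Q U (suc n))
        ≈⟨ window-cross (ℕₚ.+-comm (suc m) 1) (ℕₚ.+-comm (suc n) 1) ⟩
      crossQ w u (suc m) (suc n)
        ≈⟨ crossQ-cong (λ α β → trans (cross-comm w u _ _)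
                                      (cross-invariant u-horadam w-horadam (indices α β))) ⟩
      crossQ u w 1 (m Nat.+ suc n)
        ≈⟨ window-cross ≡.refl ≡.refl ⟨
      U 2 *Q W (suc m Nat.+ suc n) +Q q ·Q (U 1 *Q W (m Nat.+ suc n)) ∎
      where
      indices : ∀ α β → β Nat.+ suc n Nat.+ (α Nat.+ suc m) ≡ α Nat.+ 1 Nat.+ (β Nat.+ (m Nat.+ suc n))
      indices α β = solve (α ∷ β ∷ m ∷ n ∷ [])

    horadamQ-product : ∀ m n →
      W (suc m Nat.+ 1) *Q W (suc n Nat.+ 1) +Q q ·Q (W (suc m) *Q W (suc n))
        ≈Q W 2 *Q W (suc m Nat.+ suc n) +Q q ·Q (W 1 *Q W (m Nat.+ suc n))
    horadamQ-product m n = begin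
      W (suc m Nat.+ 1) *Q W (suc n Nat.+ 1) +Q q ·Q (W (suc m) *Q W (suc n))
        ≈⟨ window-cross (ℕₚ.+-comm (suc m) 1) (ℕₚ.+-comm (suc n) 1) ⟩
      crossQ w w (suc m) (suc n)
        ≈⟨ crossQ-cong (λ α β → cross-invariant w-horadam w-horadam (indices α β)) ⟩
      crossQ w w 1 (m Nat.+ suc n)
        ≈⟨ window-cross ≡.refl ≡.refl ⟨
      W 2 *Q W (suc m Nat.+ suc n) +Q q ·Q (W 1 *Q W (m Nat.+ suc n)) ∎
      where
      indices : ∀ α β → α Nat.+ suc m Nat.+ (β Nat.+ suc n) ≡ α Nat.+ 1 Nat.+ (β Nat.+ (m Nat.+ suc n))
      indices α β = solve (α ∷ β ∷ m ∷ n ∷ [])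

open Nat using (_+_; _∸_; _≤_; s≤s; z≤n)

theorem2p2 : ∀ {c ℓ : Level} (R : CommutativeRing c ℓ) →
    let open CommutativeRing R using (Carrier)
    in (p q w₀ w₁ : Carrier) (m n : ℕ) → 1 ≤ m → 1 ≤ n →
    let open CommutativeRing R using (_*_)
        open Quaternion R
        w = horadam w₀ w₁ p q
        u = fib p q
        W = horadamQ w₀ w₁ p q
        U = fibQ p q
    in (w n ·Q U (m + 1) +Q (q * w (n ∸ 1)) ·Q U m ≈Q W (n + m))
     × (u n ·Q W (m + 1) +Q (q * u (n ∸ 1)) ·Q W m ≈Q W (n + m))
     × (W (m + 1) *Q U (n + 1) +Q q ·Q (W m *Q U n)
          ≈Q U 2 *Q W (m + n) +Q q ·Q (U 1 *Q W (m + n ∸ 1)))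
     × (W (m + 1) *Q W (n + 1) +Q q ·Q (W m *Q W n)
          ≈Q W 2 *Q W (m + n) +Q q ·Q (W 1 *Q W (m + n ∸ 1)))
theorem2p2 R p q w₀ w₁ (suc m) (suc n) (s≤s z≤n) (s≤s z≤n) =
    horadamQ-by-fibQ (suc m) n
  , horadamQ-by-fib (suc m) n
  , horadamQ-fibQ-product m n
  , horadamQ-product m n
  where open HoradamQuaternions.HoradamIdentities R p q w₀ w₁
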